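{- Let $H=(V,E)$ be an $n$-uniform hypergraph, $r\geq 2$, $p\in(0,1/2)$, $c^0:V\to\{0,\dots,r-1\}$ and $\sigma:V\to[0,1]$ injective. Suppose that, with respect to $\sigma$ and $c^0$, no edge of $H$ is both degenerate and dangerous, and that the recoloring algorithm run on input $(c^0,\sigma)$ returns a coloring which is not proper (i.e. has a monochromatic edge). Then there exists a complete h-tree with respect to $\sigma$ and $c^0$.
   Context: Write $(m)_r$ for $m \bmod r$. Fix $p\in(0,1/2)$. Given an initial coloring $c^0:V\to\{0,\dots,r-1\}$ and an injective weight function $\sigma:V\to[0,1]$: a vertex $v$ is free if $\sigma(v)\leq p$; $v$ is a $j$-vertex if $c^0(v)=j$; the first vertex of a set of vertices is its vertex of minimum weight. The recoloring algorithm starts with $c=c^0$ and, while there exists an edge monochromatic under the current $c$ whose first vertex among the vertices not yet recolored is free, recolors that vertex $v$ by $c(v)\gets (c(v)+1)_r$; it then returns $c$ (each vertex is recolored at most once). An edge $f$ is degenerate if it contains at least $n/2$ free vertices. It is dangerous if there is $i\in\{0,\dots,r-1\}$ (a dominating color of $f$) such that every non-free vertex of $f$ is an $i$-vertex and every free vertex of $f$ is an $i$-vertex or an $(i-1)_r$-vertex; a dangerous non-degenerate edge has a unique dominating color. An h-tree is a rooted tree in which each node $x$ is labelled by an edge $e(x)$ of $H$ and each tree edge $\{x_1,x_2\}$ is labelled by a vertex lying in $e(x_1)\cap e(x_2)$. An h-tree consisting of a single node $x$ is alternating if $e(x)$ is dangerous and not degenerate. An h-tree with root $x$ and direct subtrees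 (subtrees rooted at the children of the root) $t_0,\dots,t_{k-1}$ with roots $y_0,\dots,y_{k-1}$ is alternating if: $e(x)$ is dangerous and not degenerate, with dominating color $i$; every $t_j$ is alternating; every $e(y_j)$ has dominating color $(i-1)_r$; for every $j$ the first $(i-1)_r$-vertex of $e(y_j)$ belongs to $e(x)$; and every free $(i-1)_r$-vertex of $e(x)$ is the first $(i-1)_r$-vertex of some $e(y_j)$. An alternating h-tree is downward complete if for every leaf $y$, with $i$ the dominating color of $e(y)$, $e(y)$ contains no free $(i-1)_r$-vertex. It is complete if moreover the root edge contains no free vertex initially colored with the root's dominating color.
   Formalization: The weight function σ takes rational values in [0,1] and the parameter p is a rational number in (0,1/2), rather than real ones. -}

module Defs where

open import Data.Nat using (ℕ; zero; suc; _+_; _*_; _∸_; _≤_; NonZero)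
open import Data.Nat.DivMod using (_mod_)
open import Data.Fin using (Fin; toℕ; _≟_)
open import Data.Rational using (ℚ) renaming (_≤_ to _≤ℚ_; _≤?_ to _≤ℚ?_)
open import Data.List using (List; []; _∷_; length; filter)
open import Data.List.Membership.Propositional using (_∈_; _∉_)
open import Data.List.Relation.Unary.All using (All)
open import Data.List.Relation.Unary.Any using (Any)
open import Data.Product using (Σ; ∃; ∃-syntax; _×_; _,_; proj₁; proj₂)
open import Data.Sum using (_⊎_)
open import Relation.Nullary using (¬_; yes; no)
open import Relation.Binary.PropositionalEquality using (_≡_; _≢_)
open import Relation.Binary.Construct.Closure.ReflexiveTransitive using (Star)

incr : ∀ {r} .{{_ : NonZero r}} → Fin r → Fin r
incr {r} i = suc (toℕ i) mod r

decr : ∀ {r} .{{_ : NonZero r}} → Fin r → Fin r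
decr {r} i = (toℕ i + (r ∸ 1)) mod r

-- Hypergraphs: vertex set V = Fin N, an edge is a duplicate-free list of
-- vertices, the edge set is a list of edges.

Edge : ℕ → Set
Edge N = List (Fin N)

FirstOf : ∀ {N} (σ : Fin N → ℚ) (P : Fin N → Set) (e : Edge N) (v : Fin N) → Set
FirstOf σ P e v = v ∈ e × P v × (∀ w → w ∈ e → P w → σ v ≤ℚ σ w)

Monochromatic : ∀ {N r} (c : Fin N → Fin r) (e : Edge N) → Set
Monochromatic c e = ∃[ i ] (∀ v → v ∈ e → c v ≡ i)

update : ∀ {N r} (c : Fin N → Fin r) (v : Fin N) (x : Fin r) → Fin N → Fin r
update c v x u with u ≟ v
... | yes _ = x
... | no  _ = c u

module _ {N r : ℕ} .{{_ : NonZero r}}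
         (E : List (Edge N)) (n : ℕ) (p : ℚ)
         (c⁰ : Fin N → Fin r) (σ : Fin N → ℚ) where

  Free : Fin N → Set
  Free v = σ v ≤ℚ p

  -- number of free vertices of an edge (edges are duplicate-free)
  #free : Edge N → ℕ
  #free e = length (filter (λ v → σ v ≤ℚ? p) e)

  Degenerate : Edge N → Set
  Degenerate e = n ≤ 2 * #free e

  DangerousWith : Edge N → Fin r → Set
  DangerousWith e i = ∀ v → v ∈ e →
    (¬ Free v → c⁰ v ≡ i) × (Free v → c⁰ v ≡ i ⊎ c⁰ v ≡ decr i)

  Dangerous : Edge N → Set
  Dangerous e = ∃[ i ] DangerousWith e i

  -- The recolouring algorithm (nondeterministic choice of the edge).
  -- State: current colouring and the list of already recoloured vertices.

  State : Set
  State = (Fin N → Fin r) × List (Fin N)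

  data Step : State → State → Set where
    recolor : ∀ {c R} e v →
      e ∈ E → Monochromatic c e →
      FirstOf σ (λ u → u ∉ R) e v → Free v →
      Step (c , R) (update c v (incr (c v)) , v ∷ R)

  Terminal : State → Set
  Terminal s = ∀ s' → ¬ Step s s'

  Returns : (Fin N → Fin r) → Set
  Returns c = ∃[ R ] (Star Step (c⁰ , []) (c , R) × Terminal (c , R))

  Proper : (Fin N → Fin r) → Set
  Proper c = ∀ e → e ∈ E → ¬ Monochromatic c e

  -- h-trees: a node carries an edge, each child is attached through a
  -- tree edge labelled by a vertex.

  data HTree : Set where
    node : Edge N → List (Fin N × HTree) → HTree

  rootEdge : HTree → Edge N
  rootEdge (node e _) = e

  data IsHTree : HTree → Set where
    node : ∀ {e ts} → e ∈ E →
      All (λ vt → proj₁ vt ∈ e × proj₁ vt ∈ rootEdge (proj₂ vt) × IsHTree (proj₂ vt)) ts →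
      IsHTree (node e ts)

  FirstColV : Fin r → Edge N → Fin N → Set
  FirstColV j e v = FirstOf σ (λ u → c⁰ u ≡ j) e v

  data Alternating : HTree → Set where
    leaf : ∀ {e} → Dangerous e → ¬ Degenerate e → Alternating (node e [])
    branch : ∀ {e} i vt ts → let ts' = vt ∷ ts in
      DangerousWith e i → ¬ Degenerate e →
      All (λ yt →
             Alternating (proj₂ yt)
           × DangerousWith (rootEdge (proj₂ yt)) (decr i)
           × (∃[ w ] (FirstColV (decr i) (rootEdge (proj₂ yt)) w × w ∈ e))) ts' →
      (∀ w → w ∈ e → Free w → c⁰ w ≡ decr i →
         Any (λ yt → FirstColV (decr i) (rootEdge (proj₂ yt)) w) ts') →
      Alternating (node e ts')

  LeafOK : Edge N → Set
  LeafOK e = ∀ i → DangerousWith e i → ∀ w → w ∈ e → Free w → c⁰ w ≢ decr i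

  data AllLeavesOK : HTree → Set where
    leaf : ∀ {e} → LeafOK e → AllLeavesOK (node e [])
    branch : ∀ {e} vt ts → All (λ yt → AllLeavesOK (proj₂ yt)) (vt ∷ ts) →
      AllLeavesOK (node e (vt ∷ ts))

  DownwardComplete : HTree → Set
  DownwardComplete t = Alternating t × AllLeavesOK t

  Complete : HTree → Set
  Complete t = DownwardComplete t ×
    (∀ i → DangerousWith (rootEdge t) i →
       ∀ w → w ∈ rootEdge t → Free w → c⁰ w ≢ i)

{-# OPTIONS --safe #-}
-- Along any run of the algorithm one maintains: every recoloured vertex u is free, now carries
-- colour c⁰(u) + 1, and is the first c⁰(u)-vertex of the root edge of a downward complete
-- alternating h-tree whose root edge has dominating colour c⁰(u).  When v is recoloured inside
-- an edge e monochromatic of colour i, every vertex of e is an i-vertex or a recoloured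
-- (i-1)-vertex, so e is dangerous, and the trees of its recoloured vertices hang below e to
-- give such a tree for v.  The same construction applied to an edge that is still monochromatic
-- at termination gives a complete h-tree: a free i-vertex in it would make the first
-- unrecoloured vertex of the edge free, so the algorithm could not have stopped.
module Submission where

open import Data.Nat using (ℕ; suc; _+_; _*_; _%_; _≤_; pred; NonZero)
open import Data.Nat.Properties
  using (+-suc; +-comm; +-assoc; suc-pred; m≤m+n; 1+n≢n; 1+n≰n; m≤n⇒m<n∨m≡n)
open import Data.Nat.DivMod
  using (_mod_; m%n<n; %-distribˡ-+; m%n%n≡m%n; [m+n]%n≡m%n; m<n⇒m%n≡m; n%n≡0)
open import Data.Fin using (Fin; toℕ; _≟_)
open import Data.Fin.Properties using (toℕ-fromℕ<; toℕ<n; toℕ-injective)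
open import Data.Rational using (ℚ; 0ℚ; 1ℚ; ½; _<_)
open import Data.Rational.Properties using (≤-decTotalOrder; ≤-trans) renaming (_≤?_ to _≤ℚ?_)
open import Data.List using (List; []; _∷_; length; filter)
open import Data.List.Properties using (filter-all)
open import Data.List.Membership.Propositional using (_∈_; _∉_; find; lose)
open import Data.List.Membership.Propositional.Properties using (∈-filter⁺; ∈-filter⁻)
open import Data.List.Relation.Binary.Subset.Propositional using (_⊆_)
open import Data.List.Relation.Unary.All as All using (All; []; _∷_; all?)
open import Data.List.Relation.Unary.All.Properties using (¬All⇒Any¬)
open import Data.List.Relation.Unary.Any using (Any; here; there; any?)
open import Data.List.Relation.Unary.Unique.Propositional using (Unique)
open import Data.Product using (Σ; ∃-syntax; _×_; _,_; proj₁; proj₂)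
open import Data.Sum using (inj₁; inj₂)
open import Data.Empty using (⊥-elim)
open import Function using (id; _∘_)
open import Function.Definitions using (Injective)
open import Relation.Binary.Bundles using (DecTotalOrder)
open import Relation.Binary.PropositionalEquality
  using (_≡_; _≢_; refl; sym; trans; cong; subst; module ≡-Reasoning)
open import Relation.Binary.Construct.Closure.ReflexiveTransitive using (Star; ε; _◅_)
open import Relation.Nullary using (¬_; yes; no)
import Relation.Nullary.Decidable as Dec
open import Relation.Unary using (Decidable)
open import Defs as D
  using (Edge; FirstOf; Monochromatic; update; incr; decr; node; leaf; branch; recolor)

module _ {r : ℕ} .{{_ : NonZero r}} where
  open ≡-Reasoning

  toℕ-mod : ∀ m → toℕ (m mod r) ≡ m % r
  toℕ-mod m = toℕ-fromℕ< (m%n<n m r)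

  [m%r+n]%r≡[m+n]%r : ∀ m n → (m % r + n) % r ≡ (m + n) % r
  [m%r+n]%r≡[m+n]%r m n = begin
    (m % r + n) % r          ≡⟨ %-distribˡ-+ (m % r) n r ⟩
    (m % r % r + n % r) % r  ≡⟨ cong (λ k → (k + n % r) % r) (m%n%n≡m%n m r) ⟩
    (m % r + n % r) % r      ≡⟨ %-distribˡ-+ m n r ⟨
    (m + n) % r              ∎

  [toℕ+r]%r≡toℕ : ∀ (x : Fin r) → (toℕ x + r) % r ≡ toℕ x
  [toℕ+r]%r≡toℕ x = trans ([m+n]%n≡m%n (toℕ x) r) (m<n⇒m%n≡m (toℕ<n x))

  decr-incr : ∀ x → decr (incr x) ≡ x
  decr-incr x = toℕ-injective (begin
    toℕ (decr (incr x))                ≡⟨ toℕ-mod _ ⟩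
    (toℕ (incr x) + pred r) % r        ≡⟨ cong (λ k → (k + pred r) % r) (toℕ-mod _) ⟩
    (suc (toℕ x) % r + pred r) % r     ≡⟨ [m%r+n]%r≡[m+n]%r (suc (toℕ x)) (pred r) ⟩
    (suc (toℕ x) + pred r) % r         ≡⟨ cong (_% r) (+-suc (toℕ x) (pred r)) ⟨
    (toℕ x + suc (pred r)) % r         ≡⟨ cong (λ k → (toℕ x + k) % r) (suc-pred r) ⟩
    (toℕ x + r) % r                    ≡⟨ [toℕ+r]%r≡toℕ x ⟩
    toℕ x                              ∎)

  incr-decr : ∀ x → incr (decr x) ≡ x
  incr-decr x = toℕ-injective (begin
    toℕ (incr (decr x))                ≡⟨ toℕ-mod _ ⟩
    suc (toℕ (decr x)) % r             ≡⟨ cong (λ k → suc k % r) (toℕ-mod _) ⟩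
    suc ((toℕ x + pred r) % r) % r     ≡⟨ cong (_% r) (+-comm 1 _) ⟩
    ((toℕ x + pred r) % r + 1) % r     ≡⟨ [m%r+n]%r≡[m+n]%r (toℕ x + pred r) 1 ⟩
    (toℕ x + pred r + 1) % r           ≡⟨ cong (_% r) (+-assoc (toℕ x) (pred r) 1) ⟩
    (toℕ x + (pred r + 1)) % r         ≡⟨ cong (λ k → (toℕ x + k) % r) (+-comm (pred r) 1) ⟩
    (toℕ x + suc (pred r)) % r         ≡⟨ cong (λ k → (toℕ x + k) % r) (suc-pred r) ⟩
    (toℕ x + r) % r                    ≡⟨ [toℕ+r]%r≡toℕ x ⟩
    toℕ x                              ∎)

  incr≡⇒≡decr : ∀ {x y} → incr x ≡ y → x ≡ decr y
  incr≡⇒≡decr {x} refl = sym (decr-incr x)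

  incr≢id : 2 ≤ r → ∀ x → incr x ≢ x
  incr≢id 2≤r x incr-x≡x with m≤n⇒m<n∨m≡n (toℕ<n x)
  ... | inj₁ 1+x<r = 1+n≢n (begin
    suc (toℕ x)       ≡⟨ m<n⇒m%n≡m 1+x<r ⟨
    suc (toℕ x) % r   ≡⟨ toℕ-mod _ ⟨
    toℕ (incr x)      ≡⟨ cong toℕ incr-x≡x ⟩
    toℕ x             ∎)
  ... | inj₂ 1+x≡r = 1+n≰n (subst (2 ≤_) r≡1 2≤r)
    where
    x≡0 : toℕ x ≡ 0
    x≡0 = begin
      toℕ x             ≡⟨ cong toℕ incr-x≡x ⟨
      toℕ (incr x)      ≡⟨ toℕ-mod _ ⟩
      suc (toℕ x) % r   ≡⟨ cong (_% r) 1+x≡r ⟩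
      r % r             ≡⟨ n%n≡0 r ⟩
      0                 ∎
    r≡1 : r ≡ 1
    r≡1 = trans (sym 1+x≡r) (cong suc x≡0)

  decr≢id : 2 ≤ r → ∀ x → decr x ≢ x
  decr≢id 2≤r x decr-x≡x = incr≢id 2≤r x (trans (cong incr (sym decr-x≡x)) (incr-decr x))

update-≡ : ∀ {N r} (c : Fin N → Fin r) v x → update c v x v ≡ x
update-≡ c v x with v ≟ v
... | yes _ = refl
... | no v≢v = ⊥-elim (v≢v refl)

update-≢ : ∀ {N r} (c : Fin N → Fin r) {u v} x → u ≢ v → update c v x u ≡ c u
update-≢ c {u} {v} x u≢v with u ≟ v
... | yes u≡v = ⊥-elim (u≢v u≡v)
... | no _ = refl

monochromatic? : ∀ {N r} .{{_ : NonZero r}} (c : Fin N → Fin r) → Decidable (Monochromatic c)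
monochromatic? {r = r} c [] = yes (0 mod r , λ _ ())
monochromatic? c (x ∷ xs) = Dec.map′
  (λ same → c x , λ v v∈ → All.lookup same v∈)
  (λ { (i , mono) → All.tabulate λ v∈ → trans (mono _ v∈) (sym (mono x (here refl))) })
  (all? (λ v → c v ≟ c x) (x ∷ xs))

firstOf-exists : ∀ {N} (σ : Fin N → ℚ) {P : Fin N → Set} → Decidable P →
  ∀ {e w} → w ∈ e → P w → ∃[ v ] FirstOf σ P e v
firstOf-exists {N} σ {P} P? {e} {w} w∈e pw =
  v , proj₁ v-ok , proj₂ v-ok ,
  λ u u∈e pu → All.lookup (f[argmin]≤f[xs] w candidates) (∈-filter⁺ P? u∈e pu)
  where
  open import Data.List.Extrema (DecTotalOrder.totalOrder ≤-decTotalOrder)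
  candidates : List (Fin N)
  candidates = filter P? e
  v : Fin N
  v = argmin σ w candidates
  v-ok : v ∈ e × P v
  v-ok = argmin-all σ (w∈e , pw) (All.tabulate (∈-filter⁻ P?))

module Hypergraph {N r : ℕ} .{{_ : NonZero r}}
         (E : List (Edge N)) (n : ℕ) (p : ℚ) (c⁰ : Fin N → Fin r) (σ : Fin N → ℚ) where
  open import Data.List.Membership.DecPropositional (_≟_ {N}) using (_∈?_; _∉?_)

  Free : Fin N → Set
  Free = D.Free E n p c⁰ σ

  Degenerate : Edge N → Set
  Degenerate = D.Degenerate E n p c⁰ σ

  DangerousWith : Edge N → Fin r → Set
  DangerousWith = D.DangerousWith E n p c⁰ σ

  Dangerous : Edge N → Set
  Dangerous = D.Dangerous E n p c⁰ σ

  State : Set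
  State = D.State E n p c⁰ σ

  Step : State → State → Set
  Step = D.Step E n p c⁰ σ

  Terminal : State → Set
  Terminal = D.Terminal E n p c⁰ σ

  Returns : (Fin N → Fin r) → Set
  Returns = D.Returns E n p c⁰ σ

  Proper : (Fin N → Fin r) → Set
  Proper = D.Proper E n p c⁰ σ

  HTree : Set
  HTree = D.HTree E n p c⁰ σ

  rootEdge : HTree → Edge N
  rootEdge = D.rootEdge E n p c⁰ σ

  IsHTree : HTree → Set
  IsHTree = D.IsHTree E n p c⁰ σ

  FirstColV : Fin r → Edge N → Fin N → Set
  FirstColV = D.FirstColV E n p c⁰ σ

  Alternating : HTree → Set
  Alternating = D.Alternating E n p c⁰ σ

  LeafOK : Edge N → Set
  LeafOK = D.LeafOK E n p c⁰ σ

  AllLeavesOK : HTree → Set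
  AllLeavesOK = D.AllLeavesOK E n p c⁰ σ

  DownwardComplete : HTree → Set
  DownwardComplete = D.DownwardComplete E n p c⁰ σ

  Complete : HTree → Set
  Complete = D.Complete E n p c⁰ σ

  ¬Degenerate⇒∃¬Free : ∀ {e} → length e ≡ n → ¬ Degenerate e → ∃[ v ] v ∈ e × ¬ Free v
  ¬Degenerate⇒∃¬Free {e} |e|≡n ¬deg with all? (λ v → σ v ≤ℚ? p) e
  ... | no ¬allFree = find (¬All⇒Any¬ (λ v → σ v ≤ℚ? p) e ¬allFree)
  ... | yes allFree = ⊥-elim (¬deg (subst (λ k → n ≤ 2 * k) (sym #free≡n) (m≤m+n n (n + 0))))
    where
    #free≡n : D.#free E n p c⁰ σ e ≡ n
    #free≡n = trans (cong length (filter-all (λ v → σ v ≤ℚ? p) allFree)) |e|≡n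

  dominating-unique : ∀ {e i j} → length e ≡ n → ¬ Degenerate e →
    DangerousWith e i → DangerousWith e j → i ≡ j
  dominating-unique |e|≡n ¬deg dangerous-i dangerous-j with ¬Degenerate⇒∃¬Free |e|≡n ¬deg
  ... | v , v∈e , ¬free =
    trans (sym (proj₁ (dangerous-i v v∈e) ¬free)) (proj₁ (dangerous-j v v∈e) ¬free)

  first-unrecoloured-free : ∀ {R e w} → w ∈ e → w ∉ R → Free w →
    ∃[ v ] FirstOf σ (_∉ R) e v × Free v
  first-unrecoloured-free {R} w∈e w∉R w-free with firstOf-exists σ (_∉? R) w∈e w∉R
  ... | v , first@(_ , _ , v-min) = v , first , ≤-trans (v-min _ w∈e w∉R) w-free

  Certificate : Fin r → Fin N → Set
  Certificate j u = Σ HTree λ t → IsHTree t × DownwardComplete t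
    × DangerousWith (rootEdge t) j × FirstColV j (rootEdge t) u

  record Invariant (c : Fin N → Fin r) (R : List (Fin N)) : Set where
    field
      recoloured-incr : ∀ {u} → u ∈ R → c u ≡ incr (c⁰ u)
      recoloured-free : ∀ {u} → u ∈ R → Free u
      certificate     : ∀ {u} → u ∈ R → Certificate (c⁰ u) u
      unrecoloured    : ∀ {u} → u ∉ R → c u ≡ c⁰ u

  invariant-init : Invariant c⁰ []
  invariant-init = record
    { recoloured-incr = λ ()
    ; recoloured-free = λ ()
    ; certificate     = λ ()
    ; unrecoloured    = λ _ → refl
    }

  improper⇒monochromatic : ∀ {c} → ¬ Proper c → ∃[ e ] e ∈ E × Monochromatic c e
  improper⇒monochromatic {c} improper with any? (monochromatic? c) E
  ... | yes some = find some
  ... | no none = ⊥-elim (improper λ e e∈E mono → none (lose e∈E mono))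

  module Algorithm (2≤r : 2 ≤ r) (uniform : ∀ e → e ∈ E → length e ≡ n)
           (no-degenerate-dangerous : ∀ e → e ∈ E → Degenerate e → ¬ Dangerous e) where

    module MonochromaticEdge {c R} (inv : Invariant c R)
             {e} (e∈E : e ∈ E) {i} (mono : ∀ u → u ∈ e → c u ≡ i) where
      open Invariant inv

      recoloured-colour : ∀ {u} → u ∈ e → u ∈ R → c⁰ u ≡ decr i
      recoloured-colour u∈e u∈R = incr≡⇒≡decr (trans (sym (recoloured-incr u∈R)) (mono _ u∈e))

      unrecoloured-colour : ∀ {u} → u ∈ e → u ∉ R → c⁰ u ≡ i
      unrecoloured-colour u∈e u∉R = trans (sym (unrecoloured u∉R)) (mono _ u∈e)

      i-vertex-unrecoloured : ∀ {u} → u ∈ e → c⁰ u ≡ i → u ∉ R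
      i-vertex-unrecoloured u∈e c⁰u≡i u∈R =
        decr≢id 2≤r i (trans (sym (recoloured-colour u∈e u∈R)) c⁰u≡i)

      decr-vertex-recoloured : ∀ {u} → u ∈ e → c⁰ u ≡ decr i → u ∈ R
      decr-vertex-recoloured {u} u∈e c⁰u≡decr-i with u ∈? R
      ... | yes u∈R = u∈R
      ... | no u∉R = ⊥-elim (decr≢id 2≤r i (trans (sym c⁰u≡decr-i) (unrecoloured-colour u∈e u∉R)))

      dangerous : DangerousWith e i
      dangerous u u∈e with u ∈? R
      ... | yes u∈R = (λ ¬free → ⊥-elim (¬free (recoloured-free u∈R)))
                    , (λ _ → inj₂ (recoloured-colour u∈e u∈R))
      ... | no u∉R = (λ _ → unrecoloured-colour u∈e u∉R)
                   , (λ _ → inj₁ (unrecoloured-colour u∈e u∉R))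

      non-degenerate : ¬ Degenerate e
      non-degenerate deg = no-degenerate-dangerous e e∈E deg (i , dangerous)

      dominating-colour : ∀ {j} → DangerousWith e j → i ≡ j
      dominating-colour = dominating-unique (uniform e e∈E) non-degenerate dangerous

      -- The three factors of Child are the per-child conditions of IsHTree, Alternating and
      -- AllLeavesOK, in exactly their shape, so that All.unzip splits a list of children.
      Attached : Fin N × HTree → Set
      Attached yt = proj₁ yt ∈ e × proj₁ yt ∈ rootEdge (proj₂ yt) × IsHTree (proj₂ yt)

      AlternatingChild : Fin N × HTree → Set
      AlternatingChild yt = Alternating (proj₂ yt) × DangerousWith (rootEdge (proj₂ yt)) (decr i)
        × ∃[ w ] (FirstColV (decr i) (rootEdge (proj₂ yt)) w × w ∈ e)

      Child : Fin N × HTree → Set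
      Child yt = Attached yt × AlternatingChild yt × AllLeavesOK (proj₂ yt)

      Covers : List (Fin N) → List (Fin N × HTree) → Set
      Covers xs ts = ∀ w → w ∈ xs → c⁰ w ≡ decr i →
        Any (λ yt → FirstColV (decr i) (rootEdge (proj₂ yt)) w) ts

      child : ∀ {w} → w ∈ e → c⁰ w ≡ decr i →
        Σ HTree λ t → Child (w , t) × FirstColV (decr i) (rootEdge t) w
      child {w} w∈e c⁰w≡decr-i =
        let t , isHTree , (alternating , leaves) , dangerous-t , first = certificate-w in
        t , ((w∈e , proj₁ first , isHTree) , (alternating , dangerous-t , w , first , w∈e) , leaves)
          , first
        where
        certificate-w : Certificate (decr i) w
        certificate-w = subst (λ j → Certificate j w) c⁰w≡decr-i
                          (certificate (decr-vertex-recoloured w∈e c⁰w≡decr-i))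

      children : ∀ xs → xs ⊆ e → ∃[ ts ] All Child ts × Covers xs ts
      children [] _ = [] , [] , λ _ ()
      children (x ∷ xs) x∷xs⊆e with children xs (x∷xs⊆e ∘ there) | c⁰ x ≟ decr i
      ... | ts , cs , covers | no c⁰x≢decr-i =
        ts , cs , λ { _ (here refl) c⁰x≡decr-i → ⊥-elim (c⁰x≢decr-i c⁰x≡decr-i)
                    ; w (there w∈xs) → covers w w∈xs }
      ... | ts , cs , covers | yes c⁰x≡decr-i =
        let t , isChild , first = child (x∷xs⊆e (here refl)) c⁰x≡decr-i in
        (x , t) ∷ ts , isChild ∷ cs , λ { _ (here refl) _ → here first
                                        ; w (there w∈xs) → there ∘ covers w w∈xs }

      downward-complete-tree : ∃[ ts ] IsHTree (node e ts) × DownwardComplete (node e ts)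
      downward-complete-tree with children e id
      ... | [] , [] , covers =
        [] , node e∈E [] , leaf (i , dangerous) non-degenerate , leaf leaf-ok
        where
        leaf-ok : LeafOK e
        leaf-ok j dangerous-j w w∈e _ c⁰w≡decr-j with dominating-colour dangerous-j
        ... | refl with covers w w∈e c⁰w≡decr-j
        ... | ()
      ... | yt ∷ ts , cs , covers with All.unzip cs
      ...   | attached , rest with All.unzip rest
      ...     | alternating , leaves =
        yt ∷ ts , node e∈E attached
        , branch i yt ts dangerous non-degenerate alternating (λ w w∈e _ → covers w w∈e)
        , branch yt ts leaves

      certificate-of-first : ∀ {v} → FirstOf σ (_∉ R) e v → Certificate i v
      certificate-of-first (v∈e , v∉R , first) with downward-complete-tree
      ... | ts , isHTree , downward-complete =
        node e ts , isHTree , downward-complete , dangerous ,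
        (v∈e , unrecoloured-colour v∈e v∉R ,
         λ w w∈e c⁰w≡i → first w w∈e (i-vertex-unrecoloured w∈e c⁰w≡i))

      no-free-dominating : Terminal (c , R) →
        ∀ j → DangerousWith e j → ∀ w → w ∈ e → Free w → c⁰ w ≢ j
      no-free-dominating terminal j dangerous-j w w∈e w-free c⁰w≡j with dominating-colour dangerous-j
      ... | refl with first-unrecoloured-free w∈e (i-vertex-unrecoloured w∈e c⁰w≡j) w-free
      ... | v , first , v-free = terminal _ (recolor e v e∈E (i , mono) first v-free)

    invariant-step : ∀ {c R s} → Invariant c R → Step (c , R) s → Invariant (proj₁ s) (proj₂ s)
    invariant-step {c} {R} inv (recolor e v e∈E (i , mono) first@(v∈e , v∉R , _) free) = record
      { recoloured-incr = λ
          { (here refl) → trans (update-≡ c v _) (cong incr (unrecoloured v∉R))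
          ; (there u∈R) → trans (update-≢ c _ (recoloured≢v u∈R)) (recoloured-incr u∈R) }
      ; recoloured-free = λ { (here refl) → free ; (there u∈R) → recoloured-free u∈R }
      ; certificate = λ
          { (here refl) → subst (λ j → Certificate j v) (sym (unrecoloured-colour v∈e v∉R))
                                (certificate-of-first first)
          ; (there u∈R) → certificate u∈R }
      ; unrecoloured = λ u∉v∷R →
          trans (update-≢ c _ (u∉v∷R ∘ here)) (unrecoloured (u∉v∷R ∘ there))
      }
      where
      open Invariant inv
      open MonochromaticEdge inv e∈E mono using (unrecoloured-colour; certificate-of-first)
      recoloured≢v : ∀ {u} → u ∈ R → u ≢ v
      recoloured≢v u∈R refl = v∉R u∈R

    invariant-run : ∀ {s s′} → Invariant (proj₁ s) (proj₂ s) → Star Step s s′ →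
      Invariant (proj₁ s′) (proj₂ s′)
    invariant-run inv ε = inv
    invariant-run inv (step ◅ steps) = invariant-run (invariant-step inv step) steps

    complete-tree : ∀ {c} → Returns c → ¬ Proper c → ∃[ t ] IsHTree t × Complete t
    complete-tree (R , run , terminal) improper with improper⇒monochromatic improper
    ... | e , e∈E , i , mono =
      let ts , isHTree , downward-complete = downward-complete-tree in
      node e ts , isHTree , downward-complete , no-free-dominating terminal
      where open MonochromaticEdge (invariant-run invariant-init run) e∈E mono

open D

proposition1 : ∀ (N n r : ℕ) .{{_ : NonZero r}} → 2 Data.Nat.≤ r →
    (E : List (Edge N)) →
    (∀ e → e ∈ E → Unique e × length e ≡ n) →
    (p : ℚ) → 0ℚ < p → p < ½ →
    (c⁰ : Fin N → Fin r) →
    (σ : Fin N → ℚ) → Injective _≡_ _≡_ σ →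
    (∀ v → 0ℚ Data.Rational.≤ σ v × σ v Data.Rational.≤ 1ℚ) →
    (∀ e → e ∈ E → Degenerate E n p c⁰ σ e → ¬ Dangerous E n p c⁰ σ e) →
    (c : Fin N → Fin r) → Returns E n p c⁰ σ c → ¬ Proper E n p c⁰ σ c →
    ∃[ t ] (IsHTree E n p c⁰ σ t × Complete E n p c⁰ σ t)
proposition1 N n r 2≤r E uniform p _ _ c⁰ σ _ _ no-degenerate-dangerous c =
  Hypergraph.Algorithm.complete-tree E n p c⁰ σ 2≤r (λ e e∈E → proj₂ (uniform e e∈E))
    no-degenerate-dangerous
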